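{- Let $\Sigma$ be a finite totally ordered alphabet, let $W \in \Sigma^+$ have Lyndon factorization $W = L_1 L_2 \cdots L_k$, and fix $1 \le l < k$. Put $U = L_1 \cdots L_l$ and $V = L_{l+1} \cdots L_k$, so $W = UV$, and let $m = |U|$, $n = |W|$. Let $\mathrm{sort}(U)$ be the list of positions $1,\dots,m$ ordered increasingly by the lexicographic order of the suffixes $U[i,m]$, let $\mathrm{sort}(V)$ be the list of positions $m+1,\dots,n$ ordered increasingly by the lexicographic order of the suffixes $W[i,n]$ (i.e. the suffixes of $V$), and let $\mathrm{sort}(W)$ be the list of positions $1,\dots,n$ ordered increasingly by the lexicographic order of the suffixes $W[i,n]$. Then $$\mathrm{sort}(W) = \mathrm{merge}(\mathrm{sort}(U), \mathrm{sort}(V)),$$ where $\mathrm{merge}$ combines the two sorted lists into a single list sorted by the lexicographic order of the global suffixes $W[i,n]$; equivalently, $\mathrm{sort}(W)$ is an interleaving of $\mathrm{sort}(U)$ and $\mathrm{sort}(V)$ that preserves the internal order of each of the two lists.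
   Context: Words are compared in the usual lexicographic order on $\Sigma^*$ induced by the order of $\Sigma$; a proper prefix of a word is smaller than the word. A Lyndon word is a primitive nonempty word strictly smaller than all its other cyclic shifts (conjugates). The Lyndon factorization of $W$ is the unique factorization $W = L_1 \cdots L_k$ into Lyndon words with $L_1 \ge L_2 \ge \cdots \ge L_k$ lexicographically. For a word $X = x_1\cdots x_p$, $X[i,j]$ denotes $x_i\cdots x_j$. Given two lists each sorted with respect to a total order, their merge is the sorted list of all their elements. -}

module Defs where

open import Data.Nat using (ℕ; zero; suc; _∸_; _≤_; _<_)
open import Data.Fin as F using (Fin)
import Data.Fin.Properties as FP
open import Data.List using (List; []; _∷_; _++_; drop; take; length; concat; replicate; foldr; merge)
open import Data.List.Relation.Binary.Lex.Strict using (Lex-<; <-decidable)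
open import Data.List.Relation.Unary.All using (All)
open import Data.List.Relation.Unary.Linked using (Linked)
open import Data.Product using (_×_; ∃; ∃-syntax)
open import Data.Sum using (_⊎_)
open import Relation.Binary.PropositionalEquality using (_≡_; _≢_)
open import Relation.Nullary using (¬_; does)
open import Relation.Binary using (Rel; Decidable)
open import Level using (0ℓ)
open import Data.Bool using (Bool; if_then_else_)

-- The finite totally ordered alphabet Σ is Fin σ with its usual order
-- (every finite total order is isomorphic to one of these).
Word : ℕ → Set
Word σ = List (Fin σ)

-- Lexicographic strict order; a proper prefix is smaller (the `halt` case).
_<ₗ_ : ∀ {σ} → Rel (Word σ) 0ℓ
_<ₗ_ = Lex-< _≡_ F._<_

_<ₗ?_ : ∀ {σ} → Decidable (_<ₗ_ {σ})
_<ₗ?_ = <-decidable FP._≟_ FP._<?_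

_≤ₗ_ : ∀ {σ} → Rel (Word σ) 0ℓ
u ≤ₗ v = (u <ₗ v) ⊎ (u ≡ v)

rotate : ∀ {σ} → ℕ → Word σ → Word σ
rotate i w = drop i w ++ take i w

pow : ∀ {σ} → Word σ → ℕ → Word σ
pow u k = concat (replicate k u)

Primitive : ∀ {σ} → Word σ → Set
Primitive w = ¬ (∃[ u ] ∃[ k ] (2 ≤ k × w ≡ pow u k))

Lyndon : ∀ {σ} → Word σ → Set
Lyndon w = w ≢ [] × Primitive w
         × (∀ i → 0 < i → i < length w → rotate i w ≢ w → w <ₗ rotate i w)

IsLyndonFactorization : ∀ {σ} → List (Word σ) → Word σ → Set
IsLyndonFactorization Ls W =
  All Lyndon Ls × Linked (λ x y → y ≤ₗ x) Ls × concat Ls ≡ W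

-- positions are 1-based; suffix i X = X[i, |X|]
suffix : ∀ {σ} → ℕ → Word σ → Word σ
suffix i X = drop (i ∸ 1) X

range : ℕ → ℕ → List ℕ
range a zero = []
range a (suc c) = a ∷ range (suc a) c

sufLt : ∀ {σ} → Word σ → Rel ℕ 0ℓ
sufLt X i j = suffix i X <ₗ suffix j X

sufLt? : ∀ {σ} (X : Word σ) → Decidable (sufLt X)
sufLt? X i j = suffix i X <ₗ? suffix j X

insertBy : {R : Rel ℕ 0ℓ} → Decidable R → ℕ → List ℕ → List ℕ
insertBy R? x [] = x ∷ []
insertBy R? x (y ∷ ys) = if does (R? x y) then x ∷ y ∷ ys else y ∷ insertBy R? x ys

sortBy : {R : Rel ℕ 0ℓ} → Decidable R → List ℕ → List ℕ
sortBy R? = foldr (insertBy R?) []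

sortPos : ∀ {σ} → Word σ → List ℕ → List ℕ
sortPos X ps = sortBy (sufLt? X) ps

-- Call V a minimal tail of U if V ≤ Z ++ V for every suffix Z of U. Appending such a V
-- to the suffixes of U neither creates nor destroys an inequality between them: if A is a
-- proper prefix of B = A ++ Z, then A ++ V < A ++ Z ++ V because V < Z ++ V. So among the
-- positions of U the suffixes of W = U ++ V are ordered as the suffixes of U, and since
-- insertion sort of a concatenation is the merge of the sorted halves, sorting the
-- positions of W is merging sort(U) with sort(V).
--
-- In a Lyndon factorization, L_{l+1}⋯L_k is a minimal tail of L_1⋯L_l. It is enough to
-- check this factor by factor. A Lyndon word L is smaller than each proper suffix s
-- (a consequence of primitivity via the Lyndon–Schützenberger lemma), and for the next
-- factor M ≤ L this forces M ≤ s: either they differ at some position, which settles the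
-- comparison of s ++ M ⋯ with M ⋯, or s = M ++ u and we continue with the shorter suffix u.

module Submission where

open import Defs
open import Data.Nat using (ℕ; zero; suc; _≤_; _<_; _+_; _∸_; z≤n; s≤s; z<s)
open import Data.Nat.Induction using (<-wellFounded)
import Data.Nat.Properties as ℕ
import Data.Fin.Properties as FP
open import Data.List using (List; []; _∷_; _++_; length; take; drop; concat; merge)
open import Data.List.Properties
  using (++-assoc; ++-identityʳ; ++-identityˡ-unique; ++-cancelˡ; ++-conicalʳ; ∷-injective;
         length-++; length-++-comm; take++drop≡id; concat-++)
open import Data.List.Relation.Binary.Lex.Core using (halt; this; next; base)
import Data.List.Relation.Binary.Lex.Strict as Lex
open import Data.List.Relation.Binary.Pointwise using (Pointwise; Pointwise-≡⇒≡; ≡⇒Pointwise-≡)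
open import Data.List.Relation.Unary.All as All using (All; []; _∷_)
open import Data.List.Relation.Unary.Linked as Linked using (Linked)
open import Data.Product using (_×_; _,_; proj₁; ∃-syntax)
open import Data.Sum using (_⊎_; inj₁; inj₂)
open import Data.Bool using (true; false; if_then_else_)
open import Data.Empty using (⊥-elim)
open import Function.Bundles using (_⇔_; mk⇔)
open import Induction.WellFounded using (Acc; acc)
open import Level using (0ℓ)
open import Relation.Binary using (Rel; Decidable; Transitive; IsStrictTotalOrder; tri<; tri≈; tri>)
open import Relation.Binary.PropositionalEquality
  using (_≡_; _≢_; refl; sym; trans; cong; cong₂; subst; subst₂; module ≡-Reasoning)
open import Relation.Nullary using (¬_; Dec; yes; no; does)
open import Relation.Nullary.Decidable using (dec-true; dec-false; does-⇔)

-- Insertion sort and merging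

module _ {R : Rel ℕ 0ℓ} (R? : Decidable R) where

  merge-< : ∀ {a b} A B → R a b → merge R? (a ∷ A) (b ∷ B) ≡ a ∷ merge R? A (b ∷ B)
  merge-< {a} {b} _ _ a<b rewrite dec-true (R? a b) a<b = refl

  merge-≮ : ∀ {a b} A B → ¬ R a b → merge R? (a ∷ A) (b ∷ B) ≡ b ∷ merge R? (a ∷ A) B
  merge-≮ {a} {b} _ _ a≮b rewrite dec-false (R? a b) a≮b = refl

  merge-[]ʳ : ∀ A → merge R? A [] ≡ A
  merge-[]ʳ []      = refl
  merge-[]ʳ (_ ∷ _) = refl

  insertBy-< : ∀ {x b} B → R x b → insertBy R? x (b ∷ B) ≡ x ∷ b ∷ B
  insertBy-< {x} {b} _ x<b rewrite dec-true (R? x b) x<b = refl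

  insertBy-≮ : ∀ {x b} B → ¬ R x b → insertBy R? x (b ∷ B) ≡ b ∷ insertBy R? x B
  insertBy-≮ {x} {b} _ x≮b rewrite dec-false (R? x b) x≮b = refl

  merge-insertBy-≮ : ∀ {x a b} A B → ¬ R a b → ¬ R x b →
                     merge R? (insertBy R? x (a ∷ A)) (b ∷ B) ≡ b ∷ merge R? (insertBy R? x (a ∷ A)) B
  merge-insertBy-≮ {x} {a} A B a≮b x≮b with does (R? x a)
  ... | true  = merge-≮ (a ∷ A) B x≮b
  ... | false = merge-≮ (insertBy R? x A) B a≮b

  insertBy≡merge : ∀ x B → insertBy R? x B ≡ merge R? (x ∷ []) B
  insertBy≡merge x []      = refl
  insertBy≡merge x (b ∷ B) with does (R? x b)
  ... | true  = refl
  ... | false = cong (b ∷_) (insertBy≡merge x B)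

  insertBy-All : ∀ {P : ℕ → Set} {x ys} → P x → All P ys → All P (insertBy R? x ys)
  insertBy-All px []                         = px ∷ []
  insertBy-All {x = x} {y ∷ _} px (py ∷ pys) with does (R? x y)
  ... | true  = px ∷ py ∷ pys
  ... | false = py ∷ insertBy-All px pys

  sortBy-All : ∀ {P : ℕ → Set} {xs} → All P xs → All P (sortBy R? xs)
  sortBy-All []         = []
  sortBy-All (px ∷ pxs) = insertBy-All px (sortBy-All pxs)

  module _ (R-trans : Transitive R) (≮-trans : Transitive (λ x y → ¬ R x y)) where
    open ≡-Reasoning

    insertBy-merge : ∀ x A B → insertBy R? x (merge R? A B) ≡ merge R? (insertBy R? x A) B
    insertBy-merge x []      B       = insertBy≡merge x B
    insertBy-merge x (a ∷ A) []      = sym (merge-[]ʳ (insertBy R? x (a ∷ A)))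
    insertBy-merge x (a ∷ A) (b ∷ B) =
      cases (R? a b) (R? x a) (R? x b) (insertBy-merge x A (b ∷ B)) (insertBy-merge x (a ∷ A) B)
      where
      cases : Dec (R a b) → Dec (R x a) → Dec (R x b) →
              insertBy R? x (merge R? A (b ∷ B)) ≡ merge R? (insertBy R? x A) (b ∷ B) →
              insertBy R? x (merge R? (a ∷ A) B) ≡ merge R? (insertBy R? x (a ∷ A)) B →
              insertBy R? x (merge R? (a ∷ A) (b ∷ B)) ≡ merge R? (insertBy R? x (a ∷ A)) (b ∷ B)
      cases (yes a<b) (yes x<a) _ _ _ = begin
        insertBy R? x (merge R? (a ∷ A) (b ∷ B))  ≡⟨ cong (insertBy R? x) (merge-< A B a<b) ⟩
        insertBy R? x (a ∷ merge R? A (b ∷ B))    ≡⟨ insertBy-< _ x<a ⟩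
        x ∷ a ∷ merge R? A (b ∷ B)                ≡⟨ cong (x ∷_) (merge-< A B a<b) ⟨
        x ∷ merge R? (a ∷ A) (b ∷ B)              ≡⟨ merge-< (a ∷ A) B (R-trans x<a a<b) ⟨
        merge R? (x ∷ a ∷ A) (b ∷ B)              ≡⟨ cong (λ C → merge R? C (b ∷ B)) (insertBy-< A x<a) ⟨
        merge R? (insertBy R? x (a ∷ A)) (b ∷ B)  ∎
      cases (yes a<b) (no x≮a) _ ih _ = begin
        insertBy R? x (merge R? (a ∷ A) (b ∷ B))  ≡⟨ cong (insertBy R? x) (merge-< A B a<b) ⟩
        insertBy R? x (a ∷ merge R? A (b ∷ B))    ≡⟨ insertBy-≮ _ x≮a ⟩
        a ∷ insertBy R? x (merge R? A (b ∷ B))    ≡⟨ cong (a ∷_) ih ⟩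
        a ∷ merge R? (insertBy R? x A) (b ∷ B)    ≡⟨ merge-< (insertBy R? x A) B a<b ⟨
        merge R? (a ∷ insertBy R? x A) (b ∷ B)    ≡⟨ cong (λ C → merge R? C (b ∷ B)) (insertBy-≮ A x≮a) ⟨
        merge R? (insertBy R? x (a ∷ A)) (b ∷ B)  ∎
      cases (no a≮b) (yes x<a) (yes x<b) _ _ = begin
        insertBy R? x (merge R? (a ∷ A) (b ∷ B))  ≡⟨ cong (insertBy R? x) (merge-≮ A B a≮b) ⟩
        insertBy R? x (b ∷ merge R? (a ∷ A) B)    ≡⟨ insertBy-< _ x<b ⟩
        x ∷ b ∷ merge R? (a ∷ A) B                ≡⟨ cong (x ∷_) (merge-≮ A B a≮b) ⟨
        x ∷ merge R? (a ∷ A) (b ∷ B)              ≡⟨ merge-< (a ∷ A) B x<b ⟨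
        merge R? (x ∷ a ∷ A) (b ∷ B)              ≡⟨ cong (λ C → merge R? C (b ∷ B)) (insertBy-< A x<a) ⟨
        merge R? (insertBy R? x (a ∷ A)) (b ∷ B)  ∎
      cases (no a≮b) (no x≮a) (yes x<b) _ _ = ⊥-elim (≮-trans x≮a a≮b x<b)
      cases (no a≮b) _ (no x≮b) _ ih = begin
        insertBy R? x (merge R? (a ∷ A) (b ∷ B))  ≡⟨ cong (insertBy R? x) (merge-≮ A B a≮b) ⟩
        insertBy R? x (b ∷ merge R? (a ∷ A) B)    ≡⟨ insertBy-≮ _ x≮b ⟩
        b ∷ insertBy R? x (merge R? (a ∷ A) B)    ≡⟨ cong (b ∷_) ih ⟩
        b ∷ merge R? (insertBy R? x (a ∷ A)) B    ≡⟨ merge-insertBy-≮ A B a≮b x≮b ⟨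
        merge R? (insertBy R? x (a ∷ A)) (b ∷ B)  ∎

    sortBy-++ : ∀ xs ys → sortBy R? (xs ++ ys) ≡ merge R? (sortBy R? xs) (sortBy R? ys)
    sortBy-++ []       ys = refl
    sortBy-++ (x ∷ xs) ys = begin
      insertBy R? x (sortBy R? (xs ++ ys))                   ≡⟨ cong (insertBy R? x) (sortBy-++ xs ys) ⟩
      insertBy R? x (merge R? (sortBy R? xs) (sortBy R? ys)) ≡⟨ insertBy-merge x (sortBy R? xs) (sortBy R? ys) ⟩
      merge R? (sortBy R? (x ∷ xs)) (sortBy R? ys)          ∎

module _ {R₁ R₂ : Rel ℕ 0ℓ} (R₁? : Decidable R₁) (R₂? : Decidable R₂) {P : ℕ → Set}
         (agree : ∀ {x y} → P x → P y → does (R₁? x y) ≡ does (R₂? x y)) where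

  insertBy-cong : ∀ {x ys} → P x → All P ys → insertBy R₁? x ys ≡ insertBy R₂? x ys
  insertBy-cong px []                 = refl
  insertBy-cong {x} {y ∷ ys} px (py ∷ pys) =
    cong₂ (λ b zs → if b then x ∷ y ∷ ys else y ∷ zs) (agree px py) (insertBy-cong px pys)

  sortBy-cong : ∀ {xs} → All P xs → sortBy R₁? xs ≡ sortBy R₂? xs
  sortBy-cong []         = refl
  sortBy-cong {x ∷ xs} (px ∷ pxs) =
    trans (cong (insertBy R₁? x) (sortBy-cong pxs)) (insertBy-cong px (sortBy-All R₂? pxs))

range-++ : ∀ a b c → range a (b + c) ≡ range a b ++ range (b + a) c
range-++ a zero    c = refl
range-++ a (suc b) c =
  cong (a ∷_) (trans (range-++ (suc a) b c) (cong (λ a′ → range (suc a) b ++ range a′ c) (ℕ.+-suc b a)))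

range-All-< : ∀ a c → All (_< a + c) (range a c)
range-All-< a zero    = []
range-All-< a (suc c) =
  ℕ.m<m+n a z<s ∷ subst (λ n → All (_< n) (range (suc a) c)) (sym (ℕ.+-suc a c))
                          (range-All-< (suc a) c)

-- Lexicographic order on words

module _ {A : Set} where

  ++≡++⇒comparable : ∀ (xs zs : List A) {ys ws} → xs ++ ys ≡ zs ++ ws →
                     (∃[ vs ] zs ≡ xs ++ vs) ⊎ (∃[ vs ] xs ≡ zs ++ vs)
  ++≡++⇒comparable []       zs       _ = inj₁ (zs , refl)
  ++≡++⇒comparable (x ∷ xs) []       _ = inj₂ (x ∷ xs , refl)
  ++≡++⇒comparable (x ∷ xs) (z ∷ zs) e with ∷-injective e
  ... | refl , e′ with ++≡++⇒comparable xs zs e′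
  ...   | inj₁ (vs , refl) = inj₁ (vs , refl)
  ...   | inj₂ (vs , refl) = inj₂ (vs , refl)

  ≢[]⇒length>0 : ∀ {xs : List A} → xs ≢ [] → 0 < length xs
  ≢[]⇒length>0 {[]}    xs≢[] = ⊥-elim (xs≢[] refl)
  ≢[]⇒length>0 {_ ∷ _} _     = z<s

  length-<-++ : ∀ {xs ys : List A} → xs ≢ [] → length ys < length (xs ++ ys)
  length-<-++ {xs} {ys} xs≢[] =
    subst (length ys <_) (sym (length-++ xs)) (ℕ.m<n+m (length ys) (≢[]⇒length>0 xs≢[]))

  take-length-++ : ∀ (xs ys : List A) → take (length xs) (xs ++ ys) ≡ xs
  take-length-++ []       ys = refl
  take-length-++ (x ∷ xs) ys = cong (x ∷_) (take-length-++ xs ys)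

  drop-length-++ : ∀ (xs ys : List A) → drop (length xs) (xs ++ ys) ≡ ys
  drop-length-++ []       ys = refl
  drop-length-++ (x ∷ xs) ys = drop-length-++ xs ys

  drop-++-≤ : ∀ {k} (xs ys : List A) → k ≤ length xs → drop k (xs ++ ys) ≡ drop k xs ++ ys
  drop-++-≤ {zero}  xs       ys _           = refl
  drop-++-≤ {suc k} (x ∷ xs) ys (s≤s k≤n) = drop-++-≤ xs ys k≤n

  concat-take++drop : ∀ l (xss : List (List A)) → concat xss ≡ concat (take l xss) ++ concat (drop l xss)
  concat-take++drop l xss =
    trans (cong concat (sym (take++drop≡id l xss))) (sym (concat-++ (take l xss) (drop l xss)))

module _ {σ : ℕ} where

  private
    <ₗ-isStrictTotalOrder : IsStrictTotalOrder (Pointwise _≡_) (_<ₗ_ {σ})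
    <ₗ-isStrictTotalOrder = Lex.<-isStrictTotalOrder FP.<-isStrictTotalOrder

  open IsStrictTotalOrder <ₗ-isStrictTotalOrder
    using () renaming (trans to <ₗ-trans; asym to <ₗ-asym)

  <ₗ-irrefl : ∀ {X : Word σ} → ¬ X <ₗ X
  <ₗ-irrefl = IsStrictTotalOrder.irrefl <ₗ-isStrictTotalOrder (≡⇒Pointwise-≡ refl)

  <ₗ-or-≥ : ∀ (X Y : Word σ) → X <ₗ Y ⊎ Y ≤ₗ X
  <ₗ-or-≥ X Y with IsStrictTotalOrder.compare <ₗ-isStrictTotalOrder X Y
  ... | tri< X<Y _ _ = inj₁ X<Y
  ... | tri≈ _ X≈Y _ = inj₂ (inj₂ (sym (Pointwise-≡⇒≡ X≈Y)))
  ... | tri> _ _ Y<X = inj₂ (inj₁ Y<X)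

  ≤ₗ-trans : Transitive (_≤ₗ_ {σ})
  ≤ₗ-trans (inj₁ X<Y) (inj₁ Y<Z) = inj₁ (<ₗ-trans X<Y Y<Z)
  ≤ₗ-trans X≤Y        (inj₂ refl) = X≤Y
  ≤ₗ-trans (inj₂ refl) Y≤Z        = Y≤Z

  <ₗ⇒≱ₗ : ∀ {X Y : Word σ} → X <ₗ Y → ¬ Y ≤ₗ X
  <ₗ⇒≱ₗ X<Y (inj₁ Y<X) = <ₗ-asym X<Y Y<X
  <ₗ⇒≱ₗ X<Y (inj₂ refl) = <ₗ-irrefl X<Y

  ≮ₗ-trans : Transitive (λ (X Y : Word σ) → ¬ X <ₗ Y)
  ≮ₗ-trans {X} {Y} {Z} X≮Y Y≮Z X<Z with <ₗ-or-≥ X Y | <ₗ-or-≥ Y Z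
  ... | inj₁ X<Y | _        = X≮Y X<Y
  ... | _        | inj₁ Y<Z = Y≮Z Y<Z
  ... | inj₂ Y≤X | inj₂ Z≤Y = <ₗ⇒≱ₗ X<Z (≤ₗ-trans Z≤Y Y≤X)

  []-≤ₗ : ∀ (X : Word σ) → [] ≤ₗ X
  []-≤ₗ []      = inj₂ refl
  []-≤ₗ (_ ∷ _) = inj₁ halt

  ++-monoʳ-<ₗ : ∀ (P : Word σ) {X Y} → X <ₗ Y → (P ++ X) <ₗ (P ++ Y)
  ++-monoʳ-<ₗ []      X<Y = X<Y
  ++-monoʳ-<ₗ (_ ∷ P) X<Y = next refl (++-monoʳ-<ₗ P X<Y)

  ++-monoʳ-≤ₗ : ∀ (P : Word σ) {X Y} → X ≤ₗ Y → (P ++ X) ≤ₗ (P ++ Y)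
  ++-monoʳ-≤ₗ P (inj₁ X<Y)  = inj₁ (++-monoʳ-<ₗ P X<Y)
  ++-monoʳ-≤ₗ P (inj₂ refl) = inj₂ refl

  ++-cancelˡ-<ₗ : ∀ (P : Word σ) {X Y} → (P ++ X) <ₗ (P ++ Y) → X <ₗ Y
  ++-cancelˡ-<ₗ []      X<Y           = X<Y
  ++-cancelˡ-<ₗ (_ ∷ P) (this p<p)    = ⊥-elim (FP.<-irrefl refl p<p)
  ++-cancelˡ-<ₗ (_ ∷ P) (next _ PX<PY) = ++-cancelˡ-<ₗ P PX<PY

  infix 4 _≪_
  _≪_ : Rel (Word σ) 0ℓ
  X ≪ Y = ∀ X′ Y′ → (X ++ X′) <ₗ (Y ++ Y′)

  <ₗ⇒≪⊎prefix : ∀ {X Y : Word σ} → X <ₗ Y → X ≪ Y ⊎ ∃[ Z ] Y ≡ X ++ Z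
  <ₗ⇒≪⊎prefix (base ())
  <ₗ⇒≪⊎prefix (halt {y} {ys}) = inj₂ (y ∷ ys , refl)
  <ₗ⇒≪⊎prefix (this x<y)      = inj₁ (λ _ _ → this x<y)
  <ₗ⇒≪⊎prefix (next refl X<Y) with <ₗ⇒≪⊎prefix X<Y
  ... | inj₁ X≪Y       = inj₁ (λ X′ Y′ → next refl (X≪Y X′ Y′))
  ... | inj₂ (Z , refl) = inj₂ (Z , refl)

  ≤ₗ⇒≪⊎prefix : ∀ {X Y : Word σ} → X ≤ₗ Y → X ≪ Y ⊎ ∃[ Z ] Y ≡ X ++ Z
  ≤ₗ⇒≪⊎prefix     (inj₁ X<Y)  = <ₗ⇒≪⊎prefix X<Y
  ≤ₗ⇒≪⊎prefix {X} (inj₂ refl) = inj₂ ([] , sym (++-identityʳ X))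

  <ₗ-sameLength⇒≪ : ∀ {X Y : Word σ} → length X ≡ length Y → X <ₗ Y → X ≪ Y
  <ₗ-sameLength⇒≪ ()  halt
  <ₗ-sameLength⇒≪ _   (this x<y)      = λ _ _ → this x<y
  <ₗ-sameLength⇒≪ |X|≡|Y| (next refl X<Y) =
    λ X′ Y′ → next refl (<ₗ-sameLength⇒≪ (ℕ.suc-injective |X|≡|Y|) X<Y X′ Y′)

  ≱ₗ⇒<ₗ : ∀ {X Y : Word σ} → ¬ Y ≤ₗ X → X <ₗ Y
  ≱ₗ⇒<ₗ {X} {Y} Y≰X with <ₗ-or-≥ X Y
  ... | inj₁ X<Y = X<Y
  ... | inj₂ Y≤X = ⊥-elim (Y≰X Y≤X)

  -- Lyndon words

  pow-+ : ∀ (u : Word σ) a b → pow u a ++ pow u b ≡ pow u (a + b)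
  pow-+ u zero    b = refl
  pow-+ u (suc a) b = trans (++-assoc u (pow u a) (pow u b)) (cong (u ++_) (pow-+ u a b))

  PowersOfCommonWord : Word σ → Word σ → Set
  PowersOfCommonWord x y = ∃[ u ] ∃[ a ] ∃[ b ] (x ≡ pow u a × y ≡ pow u b)

  powersOfCommonWord-++ʳ : ∀ {x y} → PowersOfCommonWord x y → PowersOfCommonWord x (x ++ y)
  powersOfCommonWord-++ʳ (u , a , b , refl , refl) = u , a , a + b , refl , pow-+ u a b

  powersOfCommonWord-swap : ∀ {x y} → PowersOfCommonWord x y → PowersOfCommonWord y x
  powersOfCommonWord-swap (u , a , b , x≡uᵃ , y≡uᵇ) = u , b , a , y≡uᵇ , x≡uᵃ

  ++-comm⇒powersOfCommonWord : ∀ {x y : Word σ} → x ++ y ≡ y ++ x → PowersOfCommonWord x y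
  ++-comm⇒powersOfCommonWord {x} {y} = go x y (<-wellFounded _)
    where
    go : ∀ x y → Acc _<_ (length x + length y) → x ++ y ≡ y ++ x → PowersOfCommonWord x y
    go []         y          _             _ = y , 0 , 1 , refl , sym (++-identityʳ y)
    go x@(_ ∷ _)  []         _             _ = x , 1 , 0 , sym (++-identityʳ x) , refl
    go x@(_ ∷ _)  y@(_ ∷ _)  (acc smaller) xy≡yx with ++≡++⇒comparable x y xy≡yx
    ... | inj₁ (y′ , refl) = powersOfCommonWord-++ʳ (go x y′ (smaller shorter) xy′≡y′x)
      where
      shorter : length x + length y′ < length x + length (x ++ y′)
      shorter = subst (λ n → length x + length y′ < length x + n) (sym (length-++ x))
                      (ℕ.m<n+m (length x + length y′) z<s)
      xy′≡y′x : x ++ y′ ≡ y′ ++ x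
      xy′≡y′x = ++-cancelˡ x _ _ (trans xy≡yx (++-assoc x y′ x))
    ... | inj₂ (x′ , refl) =
      powersOfCommonWord-swap (powersOfCommonWord-++ʳ (go y x′ (smaller shorter) yx′≡x′y))
      where
      shorter : length y + length x′ < length (y ++ x′) + length y
      shorter = subst (λ n → length y + length x′ < n + length y) (sym (length-++ y))
                      (ℕ.m<m+n (length y + length x′) z<s)
      yx′≡x′y : y ++ x′ ≡ x′ ++ y
      yx′≡x′y = sym (++-cancelˡ y _ _ (trans (sym (++-assoc y x′ y)) xy≡yx))

  primitive⇒¬++-comm : ∀ {r s : Word σ} → Primitive (r ++ s) → r ≢ [] → s ≢ [] → r ++ s ≢ s ++ r
  primitive⇒¬++-comm {r} {s} prim r≢[] s≢[] rs≡sr with ++-comm⇒powersOfCommonWord {r} {s} rs≡sr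
  ... | u , zero  , _     , refl , _    = r≢[] refl
  ... | u , _     , zero  , _    , refl = s≢[] refl
  ... | u , suc a , suc b , refl , refl =
    prim (u , suc a + suc b , ℕ.+-mono-≤ (s≤s z≤n) (s≤s z≤n) , pow-+ u (suc a) (suc b))

  rotate-length-++ : ∀ (r s : Word σ) → rotate (length r) (r ++ s) ≡ s ++ r
  rotate-length-++ r s = cong₂ _++_ (drop-length-++ r s) (take-length-++ r s)

  lyndon-<ₗ-rotation : ∀ {L r s : Word σ} → Lyndon L → L ≡ r ++ s → r ≢ [] → s ≢ [] → L <ₗ (s ++ r)
  lyndon-<ₗ-rotation {r = r} {s} (_ , prim , <ₗ-rotations) refl r≢[] s≢[] =
    subst ((r ++ s) <ₗ_) (rotate-length-++ r s)
      (<ₗ-rotations (length r) (≢[]⇒length>0 r≢[]) |r|<|rs|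
        (λ rot≡rs → primitive⇒¬++-comm prim r≢[] s≢[] (trans (sym rot≡rs) (rotate-length-++ r s))))
    where
    |r|<|rs| : length r < length (r ++ s)
    |r|<|rs| = subst (length r <_) (length-++-comm s r) (length-<-++ s≢[])

  lyndon-<ₗ-properSuffix : ∀ {L r s : Word σ} → Lyndon L → L ≡ r ++ s → r ≢ [] → s ≢ [] → L <ₗ s
  -- If s ≤ L then L = s ++ t with |t| = |r|; the rotation inequalities L < s ++ r and
  -- L < t ++ s give t < r, hence t ++ s < r ++ s = L, a contradiction.
  lyndon-<ₗ-properSuffix {L} {r} {s} lyn L≡rs r≢[] s≢[] = ≱ₗ⇒<ₗ s≰L
    where
    L<sr : L <ₗ (s ++ r)
    L<sr = lyndon-<ₗ-rotation lyn L≡rs r≢[] s≢[]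

    s≰L : ¬ s ≤ₗ L
    s≰L s≤L with ≤ₗ⇒≪⊎prefix s≤L
    ... | inj₁ s≪L = <ₗ-asym L<sr (subst ((s ++ r) <ₗ_) (++-identityʳ L) (s≪L r []))
    ... | inj₂ ([] , L≡s[]) =
      r≢[] (++-identityˡ-unique r (trans (sym (trans L≡s[] (++-identityʳ s))) L≡rs))
    ... | inj₂ (t@(_ ∷ _) , L≡st) = <ₗ-asym (lyndon-<ₗ-rotation lyn L≡st s≢[] (λ ())) ts<L
      where
      t<r : t <ₗ r
      t<r = ++-cancelˡ-<ₗ s (subst (_<ₗ (s ++ r)) L≡st L<sr)
      |t|≡|r| : length t ≡ length r
      |t|≡|r| = ℕ.+-cancelˡ-≡ (length s) _ _
        (trans (sym (length-++ s))
          (trans (cong length (trans (sym L≡st) L≡rs)) (trans (length-++-comm r s) (length-++ s))))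
      ts<L : (t ++ s) <ₗ L
      ts<L = subst ((t ++ s) <ₗ_) (sym L≡rs) (<ₗ-sameLength⇒≪ |t|≡|r| t<r s s)

  lyndon-≤ₗ-suffix : ∀ {L p s : Word σ} → Lyndon L → L ≡ p ++ s → s ≢ [] → L ≤ₗ s
  lyndon-≤ₗ-suffix {p = []}    _   L≡s  _    = inj₂ L≡s
  lyndon-≤ₗ-suffix {p = _ ∷ _} lyn L≡ps s≢[] = inj₁ (lyndon-<ₗ-properSuffix lyn L≡ps (λ ()) s≢[])

  -- Minimal tails

  MinimalTail : Word σ → Word σ → Set
  MinimalTail U V = ∀ p Z → U ≡ p ++ Z → V ≤ₗ (Z ++ V)

  minimalTail-[]ˡ : ∀ {V} → MinimalTail [] V
  minimalTail-[]ˡ p Z []≡pZ rewrite ++-conicalʳ p Z (sym []≡pZ) = inj₂ refl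

  minimalTail-[]ʳ : ∀ {U} → MinimalTail U []
  minimalTail-[]ʳ _ Z _ = []-≤ₗ (Z ++ [])

  minimalTail-++ : ∀ {N T V} → MinimalTail N (T ++ V) → MinimalTail T V → MinimalTail (N ++ T) V
  minimalTail-++ {N} {T} {V} N-min T-min p Z NT≡pZ with ++≡++⇒comparable N p NT≡pZ
  ... | inj₁ (q , refl) = T-min q Z (++-cancelˡ N _ _ (trans NT≡pZ (++-assoc N q Z)))
  ... | inj₂ (s , refl) = subst (V ≤ₗ_) (sym (trans (cong (_++ V) Z≡sT) (++-assoc s T V)))
                                (≤ₗ-trans (T-min [] T refl) (N-min p s refl))
    where
    Z≡sT : Z ≡ s ++ T
    Z≡sT = sym (++-cancelˡ p _ _ (trans (sym (++-assoc p s T)) NT≡pZ))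

  lyndon-minimalTail-∷ : ∀ {L M V} → Lyndon L → M ≢ [] → M ≤ₗ L → V ≤ₗ (M ++ V) →
                          MinimalTail L (M ++ V)
  lyndon-minimalTail-∷ {L} {M} {V} lyn M≢[] M≤L V≤MV _ Z L≡pZ = go Z (<-wellFounded _) L≡pZ
    where
    go : ∀ {p} s → Acc _<_ (length s) → L ≡ p ++ s → (M ++ V) ≤ₗ (s ++ M ++ V)
    go []          _             _     = inj₂ refl
    go {p} s@(_ ∷ _) (acc smaller) L≡ps with <ₗ-or-≥ s M
    ... | inj₁ s<M = ⊥-elim (<ₗ⇒≱ₗ s<M (≤ₗ-trans M≤L (lyndon-≤ₗ-suffix lyn L≡ps (λ ()))))
    ... | inj₂ M≤s with ≤ₗ⇒≪⊎prefix M≤s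
    ...   | inj₁ M≪s        = inj₁ (M≪s V (M ++ V))
    ...   | inj₂ (u , s≡Mu) =
      subst ((M ++ V) ≤ₗ_) (sym (trans (cong (_++ M ++ V) s≡Mu) (++-assoc M u (M ++ V))))
        (++-monoʳ-≤ₗ M (≤ₗ-trans V≤MV (go u (smaller |u|<|s|) L≡pMu)))
      where
      |u|<|s| : length u < length s
      |u|<|s| = subst (length u <_) (cong length (sym s≡Mu)) (length-<-++ M≢[])
      L≡pMu : L ≡ (p ++ M) ++ u
      L≡pMu = trans L≡ps (trans (cong (p ++_) s≡Mu) (sym (++-assoc p M u)))

  lyndon-minimalTail : ∀ {L Ms} → Lyndon L → All Lyndon Ms → Linked (λ x y → y ≤ₗ x) (L ∷ Ms) →
                       MinimalTail L (concat Ms)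
  lyndon-minimalTail _   []                _               = minimalTail-[]ʳ
  lyndon-minimalTail lyn (lynM ∷ lyndons) (M≤L Linked.∷ chain) =
    lyndon-minimalTail-∷ lyn (proj₁ lynM) M≤L (lyndon-minimalTail lynM lyndons chain [] _ refl)

  lyndonFactors-minimalTail : ∀ {Ls} → All Lyndon Ls → Linked (λ x y → y ≤ₗ x) Ls →
                              ∀ l → MinimalTail (concat (take l Ls)) (concat (drop l Ls))
  lyndonFactors-minimalTail _                _     zero    = minimalTail-[]ˡ
  lyndonFactors-minimalTail []               _     (suc l) = minimalTail-[]ˡ
  lyndonFactors-minimalTail {N ∷ Ns} (lynN ∷ lyndons) chain (suc l) =
    minimalTail-++ (subst (MinimalTail N) (concat-take++drop l Ns) (lyndon-minimalTail lynN lyndons chain))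
                   (lyndonFactors-minimalTail lyndons (Linked.tail chain) l)

  module _ {U V : Word σ} (U-min : MinimalTail U V) where

    suffix-++-<ₗ : ∀ {q A B} → U ≡ q ++ B → A <ₗ B → (A ++ V) <ₗ (B ++ V)
    suffix-++-<ₗ {q} {A} {B} U≡qB A<B with <ₗ⇒≪⊎prefix A<B
    ... | inj₁ A≪B = A≪B V V
    ... | inj₂ ([] , B≡A[]) = ⊥-elim (<ₗ-irrefl (subst (A <ₗ_) (trans B≡A[] (++-identityʳ A)) A<B))
    ... | inj₂ (u@(_ ∷ _) , B≡Au) =
      subst ((A ++ V) <ₗ_) (sym (trans (cong (_++ V) B≡Au) (++-assoc A u V))) (++-monoʳ-<ₗ A V<uV)
      where
      V<uV : V <ₗ (u ++ V)
      V<uV with U-min (q ++ A) u (trans U≡qB (trans (cong (q ++_) B≡Au) (sym (++-assoc q A u))))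
      ... | inj₁ V<uV = V<uV
      ... | inj₂ V≡uV with () ← ++-identityˡ-unique u V≡uV

    suffix-++-<ₗ⇔ : ∀ {p q A B} → U ≡ p ++ A → U ≡ q ++ B → A <ₗ B ⇔ (A ++ V) <ₗ (B ++ V)
    suffix-++-<ₗ⇔ {A = A} {B} U≡pA U≡qB = mk⇔ (suffix-++-<ₗ U≡qB) reflect
      where
      reflect : (A ++ V) <ₗ (B ++ V) → A <ₗ B
      reflect AV<BV with <ₗ-or-≥ A B
      ... | inj₁ A<B         = A<B
      ... | inj₂ (inj₁ B<A)  = ⊥-elim (<ₗ-asym AV<BV (suffix-++-<ₗ U≡pA B<A))
      ... | inj₂ (inj₂ refl) = ⊥-elim (<ₗ-irrefl AV<BV)

    suffix-++ : ∀ {i} → i ≤ length U → suffix i (U ++ V) ≡ suffix i U ++ V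
    suffix-++ {i} i≤|U| = drop-++-≤ U V (ℕ.≤-trans (ℕ.m∸n≤m i 1) i≤|U|)

    sufLt-++⇔ : ∀ {i j} → i ≤ length U → j ≤ length U → sufLt U i j ⇔ sufLt (U ++ V) i j
    sufLt-++⇔ {i} {j} i≤|U| j≤|U| =
      subst₂ (λ X Y → sufLt U i j ⇔ (X <ₗ Y)) (sym (suffix-++ i≤|U|)) (sym (suffix-++ j≤|U|))
        (suffix-++-<ₗ⇔ (sym (take++drop≡id (i ∸ 1) U)) (sym (take++drop≡id (j ∸ 1) U)))

    sortSuffixes-++ :
      sortPos (U ++ V) (range 1 (length (U ++ V)))
        ≡ merge (sufLt? (U ++ V)) (sortPos U (range 1 (length U)))
                                  (sortPos (U ++ V) (range (length U + 1) (length V)))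
    sortSuffixes-++ = begin
      sortPos W (range 1 (length W))                      ≡⟨ cong (λ n → sortPos W (range 1 n)) (length-++ U) ⟩
      sortPos W (range 1 (m + length V))                  ≡⟨ cong (sortPos W) (range-++ 1 m (length V)) ⟩
      sortPos W (range 1 m ++ range (m + 1) (length V))   ≡⟨ sortBy-++ (sufLt? W) <ₗ-trans ≮ₗ-trans (range 1 m) _ ⟩
      merge (sufLt? W) (sortPos W (range 1 m)) (sortPos W (range (m + 1) (length V)))
                                                          ≡⟨ cong₂ (merge (sufLt? W)) sortU≡sortW refl ⟨
      merge (sufLt? W) (sortPos U (range 1 m)) (sortPos W (range (m + 1) (length V))) ∎
      where
      open ≡-Reasoning
      W = U ++ V
      m = length U
      agree : ∀ {i j} → i ≤ m → j ≤ m → does (sufLt? U i j) ≡ does (sufLt? W i j)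
      agree {i} {j} i≤m j≤m = does-⇔ (sufLt-++⇔ i≤m j≤m) (sufLt? U i j) (sufLt? W i j)
      sortU≡sortW : sortPos U (range 1 m) ≡ sortPos W (range 1 m)
      sortU≡sortW = sortBy-cong (sufLt? U) (sufLt? W) agree (All.map ℕ.≤-pred (range-All-< 1 m))

proposition1 : (σ : ℕ) (W : Word σ) (Ls : List (Word σ)) →
    IsLyndonFactorization Ls W →
    (l : ℕ) → 1 ≤ l → l < length Ls →
    let U = concat (take l Ls)
        V = concat (drop l Ls)
        m = length U
        n = length W
    in sortPos W (range 1 n)
       ≡ merge (sufLt? W) (sortPos U (range 1 m)) (sortPos W (range (m + 1) (length V)))
proposition1 σ W Ls (lyndons , chain , refl) l _ _ rewrite concat-take++drop l Ls =
  sortSuffixes-++ (lyndonFactors-minimalTail lyndons chain l)
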